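{- For every phylogenetic $X$-network $\mathcal N$, $h_T\le H$ and $H\le\delta^{h_R}\cdot h_T\le\delta^{h}$.
   Context: A phylogenetic $X$-network $\mathcal N$ is a finite directed acyclic graph with a unique vertex of in-degree $0$ (the root), whose leaves (in-degree $1$, out-degree $0$) form the set $X$, and whose other vertices are tree vertices (in-degree $1$, out-degree $\ge2$) or reticulations (in-degree $\ge2$, out-degree $1$). Edges entering tree vertices are tree edges. $\delta$ is the maximum in-degree of a reticulation; $h_R$ and $h_T$ are the maximum number of reticulations, respectively tree vertices, on a directed path in $\mathcal N$; $h=h_R+h_T$ is the height. $H$ is the maximum number of tree edges that lie on paths from the root to a single taxon, i.e. the maximum over $x\in X$ of the number of tree edges $uv$ such that $x$ is reachable from $v$. -}

module Defs where

open import Data.Nat using (ℕ; zero; suc; _≤_; _≤ᵇ_; _≡ᵇ_)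
open import Data.Bool using (Bool; true; false; _∧_)
open import Data.Fin using (Fin)
open import Data.List using (List; []; _∷_; length; filterᵇ; allFin)
open import Data.List.Relation.Unary.Linked using (Linked)
open import Data.List.Relation.Unary.Unique.Propositional using (Unique)
open import Data.List.Membership.Propositional using (_∈_)
open import Data.Product using (Σ; ∃; _×_; proj₁; proj₂; _,_)
open import Data.Sum using (_⊎_)
open import Relation.Nullary using (¬_)
open import Relation.Binary.PropositionalEquality using (_≡_)
open import Relation.Binary.Construct.Closure.ReflexiveTransitive using (Star)
open import Relation.Binary.Construct.Closure.Transitive using (TransClosure)
open import Function.Bundles using (_⇔_)

record Digraph (n : ℕ) : Set where
  field
    edge : Fin n → Fin n → Bool

module _ {n : ℕ} (G : Digraph n) where
  open Digraph G

  Adj : Fin n → Fin n → Set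
  Adj u v = edge u v ≡ true

  inDeg : Fin n → ℕ
  inDeg v = length (filterᵇ (λ u → edge u v) (allFin n))

  outDeg : Fin n → ℕ
  outDeg u = length (filterᵇ (λ v → edge u v) (allFin n))

  -- vertex types (as Boolean tests, so that they can be counted along paths)
  isRoot : Fin n → Bool
  isRoot v = inDeg v ≡ᵇ 0

  isLeaf : Fin n → Bool
  isLeaf v = (inDeg v ≡ᵇ 1) ∧ (outDeg v ≡ᵇ 0)

  isTreeVertex : Fin n → Bool
  isTreeVertex v = (inDeg v ≡ᵇ 1) ∧ (2 ≤ᵇ outDeg v)

  isReticulation : Fin n → Bool
  isReticulation v = (2 ≤ᵇ inDeg v) ∧ (outDeg v ≡ᵇ 1)

  Root Leaf TreeVertex Reticulation : Fin n → Set
  Root v = isRoot v ≡ true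
  Leaf v = isLeaf v ≡ true
  TreeVertex v = isTreeVertex v ≡ true
  Reticulation v = isReticulation v ≡ true

  Reach : Fin n → Fin n → Set
  Reach = Star Adj

  Acyclic : Set
  Acyclic = ∀ v → ¬ TransClosure Adj v v

  Path : List (Fin n) → Set
  Path vs = Σ (Fin n) (λ v → Σ (List (Fin n)) (λ ws → vs ≡ v ∷ ws)) × Linked Adj vs

  #ret : List (Fin n) → ℕ
  #ret vs = length (filterᵇ isReticulation vs)

  #tree : List (Fin n) → ℕ
  #tree vs = length (filterᵇ isTreeVertex vs)

  TreeEdge : Fin n × Fin n → Set
  TreeEdge e = Adj (proj₁ e) (proj₂ e) × TreeVertex (proj₂ e)

-- A phylogenetic network on vertex set Fin n (X = its set of leaves).
record PhyloNetwork (n : ℕ) : Set where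
  field
    graph   : Digraph n
    acyclic : Acyclic graph
    root    : Fin n
    rootIsRoot   : Root graph root
    rootUnique   : ∀ v → Root graph v → v ≡ root
    vertexTypes  : ∀ v → ¬ (v ≡ root) →
                     Leaf graph v ⊎ TreeVertex graph v ⊎ Reticulation graph v

HasCard : {A : Set} → (A → Set) → ℕ → Set
HasCard {A} P k = Σ (List A) λ xs → Unique xs × (∀ a → (a ∈ xs) ⇔ P a) × length xs ≡ k

IsMaxWithDefault : ℕ → (ℕ → Set) → ℕ → Set
IsMaxWithDefault d P m = (m ≡ d ⊎ P m) × d ≤ m × (∀ k → P k → k ≤ m)

module _ {n : ℕ} (N : PhyloNetwork n) where
  open PhyloNetwork N

  IsHR : ℕ → Set
  IsHR = IsMaxWithDefault 0 (λ k → ∃ λ vs → Path graph vs × #ret graph vs ≡ k)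

  IsHT : ℕ → Set
  IsHT = IsMaxWithDefault 0 (λ k → ∃ λ vs → Path graph vs × #tree graph vs ≡ k)

  -- δ : maximum in-degree of a reticulation (2 if there is no reticulation)
  IsDelta : ℕ → Set
  IsDelta = IsMaxWithDefault 2 (λ k → ∃ λ r → Reticulation graph r × inDeg graph r ≡ k)

  IsTreeEdgesAbove : Fin n → ℕ → Set
  IsTreeEdgesAbove x = HasCard (λ e → TreeEdge graph e × Reach graph (proj₂ e) x)

  IsH : ℕ → Set
  IsH = IsMaxWithDefault 0 (λ k → ∃ λ x → Leaf graph x × IsTreeEdgesAbove x k)

-- Every tree vertex has exactly one parent, so the tree edges above a taxon x are in
-- bijection with the tree vertices from which x is reachable.
--
-- hT ≤ H: continue a path carrying hT tree vertices down to a sink. A sink below a tree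
-- vertex is not the root, hence a leaf, and every tree vertex of the path lies above it.
--
-- H ≤ δ^hR · hT: unfold the ancestry of x into a tree, in which every ancestor occurs once
-- per path to x. If every path into v has at most r reticulations and t tree vertices, the
-- unfolding above v has at most δ^r · t tree vertices: v contributes at most one, and v
-- has at most δ parents if it is a reticulation (each entered by paths with at most r − 1
-- reticulations) and at most one parent otherwise.
--
-- Finally hT ≤ δ^hT because δ ≥ 2.

module Submission where

open import Defs
open import Data.Nat using (ℕ; zero; suc; _≤_; _<_; _+_; _*_; _^_; _∸_; z≤n; s≤s; NonZero; >-nonZero)
open import Data.Bool using (Bool; true; false; T?)
import Data.Bool as Bool
open import Data.Bool.Properties using (∧-conicalˡ; ∧-conicalʳ; T-≡)
open import Data.Fin using (Fin)
import Data.Fin as Fin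
open import Data.Fin.Induction using (spo-wellFounded)
open import Data.List
  using (List; []; _∷_; [_]; _∷ʳ_; _++_; length; map; concatMap; filter; filterᵇ; allFin; cartesianProduct)
open import Data.List.Properties using (filter-++; length-++; length-++-sucʳ; length-map; length-tabulate)
open import Data.List.Membership.Propositional using (_∈_; find; lose)
open import Data.List.Membership.Propositional.Properties
  using ( ∈-∃++; ∈-++⁻; ∈-++⁺ˡ; ∈-++⁺ʳ; ∈-concatMap⁺; ∈-concatMap⁻; ∈-filter⁺; ∈-filter⁻
        ; ∈-map⁺; ∈-map⁻; ∈-allFin; ∈-cartesianProduct⁺; ∈-length)
import Data.List.Membership.DecPropositional as DecMembership
open import Data.List.Relation.Unary.All as All using (All; []; _∷_)
import Data.List.Relation.Unary.All.Properties as All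
open import Data.List.Relation.Unary.Any using (here; there)
import Data.List.Relation.Unary.AllPairs as AllPairs
open import Data.List.Relation.Unary.Linked as Linked using (Linked; [-]; _∷_)
open import Data.List.Relation.Unary.Linked.Properties using (Linked⇒AllPairs)
open import Data.List.Relation.Unary.Unique.Propositional using (Unique; []; _∷_)
import Data.List.Relation.Unary.Unique.Propositional.Properties as Unique
open import Data.Nat.Properties
open import Data.Product using (_×_; ∃; _,_; proj₁; proj₂)
open import Data.Sum using (inj₁; inj₂)
open import Function using (_∘_; flip; mk⇔; Equivalence)
open import Induction.WellFounded using (Acc; acc)
open import Relation.Binary.Construct.Closure.ReflexiveTransitive using (ε; _◅_; _◅◅_)
open import Relation.Binary.Construct.Closure.Transitive using (TransClosure; transitive) renaming ([_] to [_]⁺)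
open import Relation.Binary.PropositionalEquality using (_≡_; _≢_; refl; sym; trans; cong; subst; resp₂; isEquivalence)
open import Relation.Binary.Structures using (IsStrictPartialOrder)
open import Relation.Nullary using (Dec; yes; no; contradiction)
open import Relation.Nullary.Decidable using (map′; _×-dec_)
open import Relation.Unary using (Decidable)

private variable
  A B : Set
  xs ys : List A

count : (A → Bool) → List A → ℕ
count p xs = length (filterᵇ p xs)

count-++ : ∀ (p : A → Bool) xs ys → count p (xs ++ ys) ≡ count p xs + count p ys
count-++ p xs ys = trans (cong length (filter-++ (T? ∘ p) xs ys)) (length-++ (filterᵇ p xs))

count-concatMap≤ : ∀ (p : A → Bool) (g : B → List A) {c} us →
  (∀ {u} → u ∈ us → count p (g u) ≤ c) → count p (concatMap g us) ≤ length us * c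
count-concatMap≤ p g [] _ = z≤n
count-concatMap≤ p g {c} (u ∷ us) g≤c = begin
  count p (g u ++ concatMap g us)
    ≡⟨ count-++ p (g u) (concatMap g us) ⟩
  count p (g u) + count p (concatMap g us)
    ≤⟨ +-mono-≤ (g≤c (here refl)) (count-concatMap≤ p g us (g≤c ∘ there)) ⟩
  c + length us * c
    ∎
  where open ≤-Reasoning

∈-filterᵇ⁺ : ∀ (p : A → Bool) {x} → x ∈ xs → p x ≡ true → x ∈ filterᵇ p xs
∈-filterᵇ⁺ p x∈xs px = ∈-filter⁺ (T? ∘ p) x∈xs (Equivalence.from T-≡ px)

∈-filterᵇ⁻ : ∀ (p : A → Bool) {x} → x ∈ filterᵇ p xs → x ∈ xs × p x ≡ true
∈-filterᵇ⁻ p x∈ = let x∈xs , px = ∈-filter⁻ (T? ∘ p) x∈ in x∈xs , Equivalence.to T-≡ px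

0<length⇒∃∈ : 0 < length xs → ∃ λ x → x ∈ xs
0<length⇒∃∈ {xs = x ∷ _} _ = x , here refl

∈-length≡1⇒≡ : length xs ≡ 1 → ∀ {x y} → x ∈ xs → y ∈ xs → x ≡ y
∈-length≡1⇒≡ {xs = _ ∷ []} _ (here refl) (here refl) = refl

Unique⇒length≤ : Unique xs → (∀ {x} → x ∈ xs → x ∈ ys) → length xs ≤ length ys
Unique⇒length≤ {xs = []} _ _ = z≤n
Unique⇒length≤ {xs = x ∷ xs} (x∉xs ∷ xs-unique) xs⊆ys with ∈-∃++ (xs⊆ys (here refl))
... | ys₁ , ys₂ , refl = begin
  suc (length xs)           ≤⟨ s≤s (Unique⇒length≤ xs-unique xs⊆ys₁ys₂) ⟩
  suc (length (ys₁ ++ ys₂)) ≡⟨ length-++-sucʳ ys₁ x ys₂ ⟨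
  length (ys₁ ++ x ∷ ys₂)   ∎
  where
  open ≤-Reasoning
  xs⊆ys₁ys₂ : ∀ {y} → y ∈ xs → y ∈ ys₁ ++ ys₂
  xs⊆ys₁ys₂ y∈xs with ∈-++⁻ ys₁ (xs⊆ys (there y∈xs))
  ... | inj₁ y∈ys₁         = ∈-++⁺ˡ y∈ys₁
  ... | inj₂ (here refl)   = contradiction refl (All.lookup x∉xs y∈xs)
  ... | inj₂ (there y∈ys₂) = ∈-++⁺ʳ ys₁ y∈ys₂

Unique-map⁺-injectiveOn : ∀ {P : A → Set} (f : A → B) →
  (∀ {x y} → P x → P y → f x ≡ f y → x ≡ y) → All P xs → Unique xs → Unique (map f xs)
Unique-map⁺-injectiveOn f inj [] [] = []
Unique-map⁺-injectiveOn f inj (px ∷ pxs) (x∉xs ∷ xs-unique) =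
  All.map⁺ (All.zipWith (λ (py , x≢y) → x≢y ∘ inj px py) (pxs , x∉xs))
  ∷ Unique-map⁺-injectiveOn f inj pxs xs-unique

filter-HasCard : ∀ {P : A → Set} (P? : Decidable P) → Unique xs → (∀ a → a ∈ xs) →
  HasCard P (length (filter P? xs))
filter-HasCard {xs = xs} P? xs-unique complete =
  filter P? xs , Unique.filter⁺ P? xs-unique ,
  (λ a → mk⇔ (proj₂ ∘ ∈-filter⁻ P? {xs = xs}) (∈-filter⁺ P? (complete a))) , refl

length≤HasCard : ∀ {P : A → Set} {k} → HasCard P k →
  Unique ys → (∀ {a} → a ∈ ys → P a) → length ys ≤ k
length≤HasCard (_ , _ , enum , refl) ys-unique ys⊆P =
  Unique⇒length≤ ys-unique (Equivalence.from (enum _) ∘ ys⊆P)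

HasCard≤length : ∀ {P : A → Set} {k} → HasCard P k →
  (∀ {a} → P a → a ∈ ys) → k ≤ length ys
HasCard≤length (xs , xs-unique , enum , refl) P⊆ys =
  Unique⇒length≤ xs-unique (P⊆ys ∘ Equivalence.to (enum _))

Linked-∷ʳ : ∀ {R : A → A → Set} xs {u v} →
  Linked R (xs ∷ʳ u) → R u v → Linked R (xs ∷ʳ u ∷ʳ v)
Linked-∷ʳ []           [-]       r = r ∷ [-]
Linked-∷ʳ (_ ∷ [])     (r₁ ∷ l) r = r₁ ∷ Linked-∷ʳ [] l r
Linked-∷ʳ (_ ∷ y ∷ xs) (r₁ ∷ l) r = r₁ ∷ Linked-∷ʳ (y ∷ xs) l r

≤-byPositive : ∀ {m n} → (0 < m → m ≤ n) → m ≤ n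
≤-byPositive {zero}  _ = z≤n
≤-byPositive {suc m} f = f (s≤s z≤n)

n<m^n : ∀ {m} → 2 ≤ m → ∀ n → n < m ^ n
n<m^n 2≤m zero = s≤s z≤n
n<m^n {m} 2≤m (suc n) = begin-strict
  suc n          ≤⟨ n<m^n 2≤m n ⟩
  m ^ n          <⟨ m<m+n (m ^ n) (≤-<-trans z≤n (n<m^n 2≤m n)) ⟩
  m ^ n + m ^ n  ≡⟨ cong (m ^ n +_) (+-identityʳ (m ^ n)) ⟨
  2 * m ^ n      ≤⟨ *-monoˡ-≤ (m ^ n) 2≤m ⟩
  m * m ^ n      ∎
  where open ≤-Reasoning

m^n*o≤m^[n+o] : ∀ {m} → 2 ≤ m → ∀ n o → m ^ n * o ≤ m ^ (n + o)
m^n*o≤m^[n+o] {m} 2≤m n o = begin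
  m ^ n * o      ≤⟨ *-monoʳ-≤ (m ^ n) (<⇒≤ (n<m^n 2≤m o)) ⟩
  m ^ n * m ^ o  ≡⟨ ^-distribˡ-+-* m n o ⟨
  m ^ (n + o)    ∎
  where open ≤-Reasoning

m+n*[o∸m]≤n*o : ∀ {m o} n .{{_ : NonZero n}} → m ≤ o → m + n * (o ∸ m) ≤ n * o
m+n*[o∸m]≤n*o {m} {o} n m≤o = begin
  m + n * (o ∸ m)      ≤⟨ +-monoˡ-≤ (n * (o ∸ m)) (m≤n*m m n) ⟩
  n * m + n * (o ∸ m)  ≡⟨ *-distribˡ-+ n m (o ∸ m) ⟨
  n * (m + (o ∸ m))    ≡⟨ cong (n *_) (m+[n∸m]≡n m≤o) ⟩
  n * o                ∎
  where open ≤-Reasoning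

module _ {n : ℕ} (G : Digraph n) where
  open Digraph G

  parents : Fin n → List (Fin n)
  parents v = filterᵇ (λ u → edge u v) (allFin n)

  children : Fin n → List (Fin n)
  children u = filterᵇ (edge u) (allFin n)

  ∈-parents⁺ : ∀ {u v} → Adj G u v → u ∈ parents v
  ∈-parents⁺ {u} = ∈-filterᵇ⁺ _ (∈-allFin u)

  ∈-parents⁻ : ∀ {u v} → u ∈ parents v → Adj G u v
  ∈-parents⁻ = proj₂ ∘ ∈-filterᵇ⁻ {xs = allFin n} _

  ∈-children⁻ : ∀ {u v} → v ∈ children u → Adj G u v
  ∈-children⁻ = proj₂ ∘ ∈-filterᵇ⁻ {xs = allFin n} _

  root-inDeg : ∀ {v} → Root G v → inDeg G v ≡ 0
  root-inDeg r = ≡ᵇ⇒≡ _ 0 (Equivalence.from T-≡ r)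

  leaf-inDeg : ∀ {v} → Leaf G v → inDeg G v ≡ 1
  leaf-inDeg l = ≡ᵇ⇒≡ _ 1 (Equivalence.from T-≡ (∧-conicalˡ _ _ l))

  treeVertex-inDeg : ∀ {v} → TreeVertex G v → inDeg G v ≡ 1
  treeVertex-inDeg t = ≡ᵇ⇒≡ _ 1 (Equivalence.from T-≡ (∧-conicalˡ _ _ t))

  treeVertex-outDeg : ∀ {v} → TreeVertex G v → 2 ≤ outDeg G v
  treeVertex-outDeg t = ≤ᵇ⇒≤ 2 _ (Equivalence.from T-≡ (∧-conicalʳ _ _ t))

  reticulation-outDeg : ∀ {v} → Reticulation G v → outDeg G v ≡ 1
  reticulation-outDeg r = ≡ᵇ⇒≡ _ 1 (Equivalence.from T-≡ (∧-conicalʳ _ _ r))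

  inDeg≡0⇒Reach⇒≡ : ∀ {w v} → inDeg G v ≡ 0 → Reach G w v → w ≡ v
  inDeg≡0⇒Reach⇒≡ _ ε = refl
  inDeg≡0⇒Reach⇒≡ z (e ◅ s) with refl ← inDeg≡0⇒Reach⇒≡ z s =
    contradiction (subst (0 <_) z (∈-length (∈-parents⁺ e))) (n≮n 0)

  treeVertex-parent : ∀ {v} → TreeVertex G v → ∃ λ u → Adj G u v
  treeVertex-parent t =
    let u , u∈ = 0<length⇒∃∈ (≤-reflexive (sym (treeVertex-inDeg t))) in u , ∈-parents⁻ u∈

  TreeEdge-head-injective : ∀ {e e′} → TreeEdge G e → TreeEdge G e′ → proj₂ e ≡ proj₂ e′ → e ≡ e′
  TreeEdge-head-injective (uv , t) (u′v , _) refl =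
    cong (_, _) (∈-length≡1⇒≡ (treeVertex-inDeg t) (∈-parents⁺ uv) (∈-parents⁺ u′v))

  trail : ∀ {u v} → Reach G u v → List (Fin n)
  trail ε                  = []
  trail (_◅_ {j = w} _ s) = w ∷ trail s

  trail-linked : ∀ {u v} (s : Reach G u v) → Linked (Adj G) (u ∷ trail s)
  trail-linked ε       = [-]
  trail-linked (e ◅ s) = e ∷ trail-linked s

  ∷ʳ-Path : ∀ q {x} → Linked (Adj G) (q ∷ʳ x) → Path G (q ∷ʳ x)
  ∷ʳ-Path []      {x} path = (x , [] , refl) , path
  ∷ʳ-Path (u ∷ q) {x} path = (u , q ∷ʳ x , refl) , path

  -- ancestors f v lists each w once for every path from w to v with fewer than f edges.
  ancestors : ℕ → Fin n → List (Fin n)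
  ancestors zero    v = []
  ancestors (suc f) v = v ∷ concatMap (ancestors f) (parents v)

  ancestors-sound : ∀ f {v w} → w ∈ ancestors f v → Reach G w v
  ancestors-sound (suc f) (here refl) = ε
  ancestors-sound (suc f) {v} (there w∈) =
    let u , u∈ , w∈u = find (∈-concatMap⁻ (ancestors f) {xs = parents v} w∈)
    in ancestors-sound f w∈u ◅◅ (∈-parents⁻ u∈ ◅ ε)

  ancestors-parent : ∀ f {v w₁ w} → w₁ ∈ ancestors f v → Adj G w w₁ → w ∈ ancestors (suc f) v
  ancestors-parent (suc f) (here refl) e =
    there (∈-concatMap⁺ (ancestors (suc f)) (lose (∈-parents⁺ e) (here refl)))
  ancestors-parent (suc f) {v} (there w₁∈) e =
    let u , u∈ , w₁∈u = find (∈-concatMap⁻ (ancestors f) {xs = parents v} w₁∈)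
    in there (∈-concatMap⁺ (ancestors (suc f)) (lose u∈ (ancestors-parent f w₁∈u e)))

  ancestors-complete : ∀ {f w v} (s : Reach G w v) → length (trail s) < f → w ∈ ancestors f v
  ancestors-complete {suc f} ε       _          = here refl
  ancestors-complete {suc f} (e ◅ s) (s≤s s<f) = ancestors-parent f (ancestors-complete s s<f) e

  module _ (acyclic : Acyclic G) where

    Linked⇒Unique : Linked (Adj G) xs → Unique xs
    Linked⇒Unique =
      AllPairs.map (λ x⁺y x≡y → acyclic _ (subst (TransClosure (Adj G) _) (sym x≡y) x⁺y))
      ∘ Linked⇒AllPairs (transitive (Adj G)) ∘ Linked.map [_]⁺

    path-length≤ : Linked (Adj G) xs → length xs ≤ n
    path-length≤ l = ≤-trans (Unique⇒length≤ (Linked⇒Unique l) (λ {v} _ → ∈-allFin v))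
                             (≤-reflexive (length-tabulate (λ i → i)))

    Reach⇒∈ancestors : ∀ {w v} → Reach G w v → w ∈ ancestors n v
    Reach⇒∈ancestors s = ancestors-complete s (path-length≤ (trail-linked s))

    reach? : ∀ w v → Dec (Reach G w v)
    reach? w v = map′ (ancestors-sound n) Reach⇒∈ancestors (w ∈? ancestors n v)
      where open DecMembership Fin._≟_

    descendant-isStrictPartialOrder : IsStrictPartialOrder _≡_ (flip (TransClosure (Adj G)))
    descendant-isStrictPartialOrder = record
      { isEquivalence = isEquivalence
      ; irrefl        = λ { refl → acyclic _ }
      ; trans         = λ v⁺u w⁺v → transitive (Adj G) w⁺v v⁺u
      ; <-resp-≈      = resp₂ _
      }

    reachesSink : ∀ v → ∃ λ x → Reach G v x × outDeg G x ≡ 0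
    reachesSink v = descend (spo-wellFounded descendant-isStrictPartialOrder v)
      where
      descend : ∀ {v} → Acc (flip (TransClosure (Adj G))) v → ∃ λ x → Reach G v x × outDeg G x ≡ 0
      descend {v} (acc below) with outDeg G v ≟ 0
      ... | yes sink = v , ε , sink
      ... | no ¬sink =
        let c , c∈ = 0<length⇒∃∈ {xs = children v} (n≢0⇒n>0 ¬sink)
            vc = ∈-children⁻ c∈
            x , c↝x , sink = descend (below [ vc ]⁺)
        in x , vc ◅ c↝x , sink

    path-reachesSink : ∀ {v vs} → Linked (Adj G) (v ∷ vs) →
      ∃ λ x → outDeg G x ≡ 0 × All (λ w → Reach G w x) (v ∷ vs)
    path-reachesSink {v} [-] = let x , v↝x , sink = reachesSink v in x , sink , v↝x ∷ []
    path-reachesSink (e ∷ l) with x , sink , w↝x ∷ ws↝x ← path-reachesSink l =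
      x , sink , (e ◅ w↝x) ∷ w↝x ∷ ws↝x

module _ {n : ℕ} (N : PhyloNetwork n) where
  open PhyloNetwork N renaming (graph to G)

  ¬reticulation⇒inDeg≤1 : ∀ v → isReticulation G v ≡ false → inDeg G v ≤ 1
  ¬reticulation⇒inDeg≤1 v ¬ret with v Fin.≟ root
  ... | yes refl = ≤-trans (≤-reflexive (root-inDeg G rootIsRoot)) z≤n
  ... | no v≢root with vertexTypes v v≢root
  ...   | inj₁ leaf        = ≤-reflexive (leaf-inDeg G leaf)
  ...   | inj₂ (inj₁ tree) = ≤-reflexive (treeVertex-inDeg G tree)
  ...   | inj₂ (inj₂ ret)  = contradiction (trans (sym ret) ¬ret) λ ()

  treeVertex-reaches-nonroot : ∀ {w x} → TreeVertex G w → Reach G w x → x ≢ root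
  treeVertex-reaches-nonroot tree w↝root refl
    with refl ← inDeg≡0⇒Reach⇒≡ G (root-inDeg G rootIsRoot) w↝root =
    contradiction (trans (sym (treeVertex-inDeg G tree)) (root-inDeg G rootIsRoot)) λ ()

  sink⇒leaf : ∀ {x} → outDeg G x ≡ 0 → x ≢ root → Leaf G x
  sink⇒leaf {x} sink x≢root with vertexTypes x x≢root
  ... | inj₁ leaf        = leaf
  ... | inj₂ (inj₁ tree) = contradiction (subst (2 ≤_) sink (treeVertex-outDeg G tree)) λ ()
  ... | inj₂ (inj₂ ret)  = contradiction (trans (sym (reticulation-outDeg G ret)) sink) λ ()

  PathsIntoBounded : Fin n → ℕ → ℕ → Set
  PathsIntoBounded v r t =
    ∀ q → Linked (Adj G) (q ∷ʳ v) → #ret G (q ∷ʳ v) ≤ r × #tree G (q ∷ʳ v) ≤ t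

  PathsIntoBounded-parent : ∀ {u v r t} → PathsIntoBounded v r t → Adj G u v →
    PathsIntoBounded u (r ∸ #ret G [ v ]) (t ∸ #tree G [ v ])
  PathsIntoBounded-parent {u} {v} bounded uv q path =
    let ret≤ , tree≤ = bounded (q ∷ʳ u) (Linked-∷ʳ q path uv)
    in m+n≤o⇒m≤o∸n _ (subst (_≤ _) (count-++ (isReticulation G) (q ∷ʳ u) [ v ]) ret≤) ,
       m+n≤o⇒m≤o∸n _ (subst (_≤ _) (count-++ (isTreeVertex G) (q ∷ʳ u) [ v ]) tree≤)

  module _ {δ : ℕ} .{{_ : NonZero δ}}
           (reticulation-inDeg≤δ : ∀ v → Reticulation G v → inDeg G v ≤ δ) where

    inDeg*δ^[r∸#ret]≤δ^r : ∀ v {r} → #ret G [ v ] ≤ r →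
      inDeg G v * δ ^ (r ∸ #ret G [ v ]) ≤ δ ^ r
    inDeg*δ^[r∸#ret]≤δ^r v {r} ret≤r with isReticulation G v in ret
    ... | true  = begin
      inDeg G v * δ ^ (r ∸ 1)  ≤⟨ *-monoˡ-≤ _ (reticulation-inDeg≤δ v ret) ⟩
      δ * δ ^ (r ∸ 1)          ≡⟨ cong (δ ^_) (m+[n∸m]≡n ret≤r) ⟩
      δ ^ r                    ∎
      where open ≤-Reasoning
    ... | false = begin
      inDeg G v * δ ^ r  ≤⟨ *-monoˡ-≤ _ (¬reticulation⇒inDeg≤1 v ret) ⟩
      1 * δ ^ r          ≡⟨ *-identityˡ (δ ^ r) ⟩
      δ ^ r              ∎
      where open ≤-Reasoning

    #tree-ancestors≤ : ∀ f v {r t} → PathsIntoBounded v r t →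
      #tree G (ancestors G f v) ≤ δ ^ r * t
    #tree-ancestors≤ zero    v _ = z≤n
    #tree-ancestors≤ (suc f) v {r} {t} bounded = begin
      #tree G ([ v ] ++ concatMap (ancestors G f) (parents G v))
        ≡⟨ count-++ (isTreeVertex G) [ v ] _ ⟩
      b + #tree G (concatMap (ancestors G f) (parents G v))
        ≤⟨ +-monoʳ-≤ b (count-concatMap≤ _ (ancestors G f) (parents G v) λ u∈ →
             #tree-ancestors≤ f _ (PathsIntoBounded-parent bounded (∈-parents⁻ G u∈))) ⟩
      b + inDeg G v * (δ ^ (r ∸ a) * (t ∸ b))
        ≡⟨ cong (b +_) (*-assoc (inDeg G v) _ _) ⟨
      b + inDeg G v * δ ^ (r ∸ a) * (t ∸ b)
        ≤⟨ +-monoʳ-≤ b (*-monoˡ-≤ (t ∸ b) (inDeg*δ^[r∸#ret]≤δ^r v a≤r)) ⟩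
      b + δ ^ r * (t ∸ b)
        ≤⟨ m+n*[o∸m]≤n*o (δ ^ r) {{m^n≢0 δ r}} b≤t ⟩
      δ ^ r * t ∎
      where
      open ≤-Reasoning
      a = #ret G [ v ]
      b = #tree G [ v ]
      a≤r : a ≤ r
      a≤r = proj₁ (bounded [] [-])
      b≤t : b ≤ t
      b≤t = proj₂ (bounded [] [-])

  ∃IsTreeEdgesAbove : ∀ x → ∃ λ k → IsTreeEdgesAbove N x k
  ∃IsTreeEdgesAbove x =
    _ , filter-HasCard treeEdgeAbove? allEdges-unique λ (u , v) →
          ∈-cartesianProduct⁺ (∈-allFin u) (∈-allFin v)
    where
    open Digraph G
    treeEdgeAbove? : Decidable (λ e → TreeEdge G e × Reach G (proj₂ e) x)
    treeEdgeAbove? (u , v) =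
      ((edge u v Bool.≟ true) ×-dec (isTreeVertex G v Bool.≟ true)) ×-dec reach? G acyclic v x
    allEdges-unique : Unique (cartesianProduct (allFin n) (allFin n))
    allEdges-unique = Unique.cartesianProduct⁺ (Unique.allFin⁺ n) (Unique.allFin⁺ n)

  treeEdgesAbove⇒treeVerticesAbove : ∀ {x k} → IsTreeEdgesAbove N x k →
    HasCard (λ w → TreeVertex G w × Reach G w x) k
  treeEdgesAbove⇒treeVerticesAbove {x} (es , es-unique , enum , refl) =
    map proj₂ es ,
    Unique-map⁺-injectiveOn proj₂ (TreeEdge-head-injective G)
      (All.tabulate (proj₁ ∘ Equivalence.to (enum _))) es-unique ,
    (λ w → mk⇔ head-above (above-head w)) ,
    length-map proj₂ es
    where
    head-above : ∀ {w} → w ∈ map proj₂ es → TreeVertex G w × Reach G w x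
    head-above w∈ with e , e∈ , refl ← ∈-map⁻ proj₂ w∈ =
      let (_ , tree) , w↝x = Equivalence.to (enum e) e∈ in tree , w↝x
    above-head : ∀ w → TreeVertex G w × Reach G w x → w ∈ map proj₂ es
    above-head w (tree , w↝x) =
      let u , uw = treeVertex-parent G tree
      in ∈-map⁺ proj₂ (Equivalence.from (enum (u , w)) ((uw , tree) , w↝x))

  #tree-path≤treeEdgesAbove : ∀ {x k vs} → Linked (Adj G) vs → All (λ w → Reach G w x) vs →
    IsTreeEdgesAbove N x k → #tree G vs ≤ k
  #tree-path≤treeEdgesAbove path path↝x edges =
    length≤HasCard (treeEdgesAbove⇒treeVerticesAbove edges)
      (Unique.filter⁺ (T? ∘ isTreeVertex G) (Linked⇒Unique G acyclic path))
      λ w∈ → let w∈path , tree = ∈-filterᵇ⁻ (isTreeVertex G) w∈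
             in tree , All.lookup path↝x w∈path

  #tree-path≤H : ∀ {H v vs} → IsH N H → Linked (Adj G) (v ∷ vs) → #tree G (v ∷ vs) ≤ H
  #tree-path≤H (_ , _ , H-max) path with x , sink , path↝x ← path-reachesSink G acyclic path =
    ≤-byPositive λ 0<#tree →
      let w , w∈ = 0<length⇒∃∈ 0<#tree
          w∈path , tree = ∈-filterᵇ⁻ (isTreeVertex G) w∈
          x-leaf = sink⇒leaf sink (treeVertex-reaches-nonroot tree (All.lookup path↝x w∈path))
          k , edges = ∃IsTreeEdgesAbove x
      in ≤-trans (#tree-path≤treeEdgesAbove path path↝x edges) (H-max k (x , x-leaf , edges))

  hT≤H : ∀ {hT H} → IsHT N hT → IsH N H → hT ≤ H
  hT≤H (inj₁ refl , _) _ = z≤n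
  hT≤H (inj₂ (_ , ((_ , _ , refl) , path) , refl) , _) isH = #tree-path≤H isH path

  treeEdgesAbove≤#tree-ancestors : ∀ {x k} → IsTreeEdgesAbove N x k → k ≤ #tree G (ancestors G n x)
  treeEdgesAbove≤#tree-ancestors edges =
    HasCard≤length (treeEdgesAbove⇒treeVerticesAbove edges) λ (tree , w↝x) →
      ∈-filterᵇ⁺ (isTreeVertex G) (Reach⇒∈ancestors G acyclic w↝x) tree

  PathsIntoBounded-hR-hT : ∀ {hR hT} → IsHR N hR → IsHT N hT → ∀ x → PathsIntoBounded x hR hT
  PathsIntoBounded-hR-hT (_ , _ , hR-max) (_ , _ , hT-max) x q path =
    hR-max _ (q ∷ʳ x , ∷ʳ-Path G q path , refl) , hT-max _ (q ∷ʳ x , ∷ʳ-Path G q path , refl)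

  H≤δ^hR*hT : ∀ {δ hR hT H} → IsDelta N δ → IsHR N hR → IsHT N hT → IsH N H →
    H ≤ δ ^ hR * hT
  H≤δ^hR*hT _ _ _ (inj₁ refl , _) = z≤n
  H≤δ^hR*hT {δ} {hR} {hT} {H} (_ , 2≤δ , δ-max) isR isT (inj₂ (x , _ , edges) , _) = begin
    H                          ≤⟨ treeEdgesAbove≤#tree-ancestors edges ⟩
    #tree G (ancestors G n x)  ≤⟨ #tree-ancestors≤ (λ v ret → δ-max _ (v , ret , refl)) n x
                                    (PathsIntoBounded-hR-hT isR isT x) ⟩
    δ ^ hR * hT                ∎
    where
    open ≤-Reasoning
    instance
      δ≢0 : NonZero δ
      δ≢0 = >-nonZero (≤-trans (s≤s z≤n) 2≤δ)

lemma4p1 : ∀ {n} (N : PhyloNetwork n) (δ hR hT H : ℕ) →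
    IsDelta N δ → IsHR N hR → IsHT N hT → IsH N H →
    hT ≤ H × H ≤ δ ^ hR * hT × δ ^ hR * hT ≤ δ ^ (hR + hT)
lemma4p1 N δ hR hT H isδ isR isT isH =
  hT≤H N isT isH ,
  H≤δ^hR*hT N isδ isR isT isH ,
  m^n*o≤m^[n+o] (proj₁ (proj₂ isδ)) hR hT
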